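{- For every nonnegative integer $n$, $$\sum_{k=0}^{n}\frac{\binom{n}{k}H_k}{k+1}\left(-\frac{4}{3}\right)^k=\frac{\left(-3+(-1/3)^n\right)H_n}{4(n+1)}-\frac{\sum_{k=1}^{n}\frac{(-3)^k}{k}}{4(-3)^n(n+1)}+\frac{3\sum_{k=1}^{n}\frac{1}{k(-3)^k}}{4(n+1)}$$ and $$\sum_{k=0}^{n}\frac{\binom{n}{k}}{(k+1)^2}\left(-\frac{4}{3}\right)^k=\frac{1}{n+1}+\frac{3\sum_{k=1}^n\frac{1}{k+1}}{4(n+1)}+\frac{\sum_{k=1}^n\frac{1}{(k+1)(-3)^k}}{4(n+1)}.$$
   Context: $H_n$ denotes the $n$th harmonic number: $H_0=0$ and $H_n=\sum_{i=1}^n 1/i$ for $n\ge1$. -}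

module Defs where

open import Data.Nat as ℕ using (ℕ; zero; suc)
open import Data.Nat.Combinatorics using (_C_)
open import Data.Integer as ℤ using (ℤ; +_)
open import Data.Rational using (ℚ; 0ℚ; 1ℚ; _+_; _*_; _-_; -_; _/_)

_^_ : ℚ → ℕ → ℚ
q ^ zero = 1ℚ
q ^ suc n = q * (q ^ n)

sumTo : (ℕ → ℚ) → ℕ → ℚ
sumTo f zero = f zero
sumTo f (suc n) = sumTo f n + f (suc n)

sum1To : (ℕ → ℚ) → ℕ → ℚ
sum1To f zero = 0ℚ
sum1To f (suc n) = sum1To f n + f (suc n)

inv-suc : ℕ → ℚ
inv-suc m = (+ 1) / suc m

ℕ→ℚ : ℕ → ℚ
ℕ→ℚ m = (+ m) / 1

-- 1 / i for i ≥ 1 (used only for i ≥ 1 in sums starting at 1)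
inv : ℕ → ℚ
inv i = (+ 1) / suc (ℕ.pred i)

H : ℕ → ℚ
H n = sum1To inv n

binom : ℕ → ℕ → ℚ
binom n k = ℕ→ℚ (n C k)

q-4/3 : ℚ
q-4/3 = ℤ.- (+ 4) / 3

q-1/3 : ℚ
q-1/3 = ℤ.- (+ 1) / 3

q-3 : ℚ
q-3 = ℤ.- (+ 3) / 1

q3 : ℚ
q3 = (+ 3) / 1

module Submission where

-- Both identities are instances of two general facts about binomial
-- transforms  Σₖ C(n,k) g(k)  over ℚ, for an arbitrary ratio x and y = 1 + x:
--
--   (absorption)  (n+1) Σₖ C(n,k) g(k+1)/(k+1) = Σₖ C(n+1,k) g(k) - g(0),
--                 which follows from (k+1) C(n+1,k+1) = (n+1) C(n,k);
--   (Pascal)      Σₖ C(n+1,k) g(k) = Σₖ C(n,k) g(k) + Σₖ C(n,k) g(k+1).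
--
-- Pascal gives, by induction on m, the binomial theorem Σ C(m,k) xᵏ = yᵐ and
-- the closed forms  Σ C(m,k) xᵏ/k = 1 + Σᵢ yⁱ/i - H_m  (the k = 0 term read
-- as 1)  and  Σ C(m,k) H_k xᵏ = yᵐ (H_m - Σᵢ y⁻ⁱ/i).  Absorption applied to
-- g(k) = xᵏ/k and to g(k) = H_{k-1} xᵏ expresses (n+1)·x times the two sums
-- of the theorem through these closed forms.  Finally we specialise to
-- x = -4/3, y = -1/3, divide by x(n+1) and collect the constants.

open import Defs
open import Data.Nat using (ℕ; suc)
import Data.Nat as ℕ
open import Data.Product using (_×_)
open import Data.Rational using (ℚ; _+_; _*_; _-_; -_)
open import Relation.Binary.PropositionalEquality using (_≡_)

open import Data.Nat using (zero)
import Data.Nat.Properties as ℕP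
import Data.Nat.Tactic.RingSolver as ℕSolver
open import Data.Nat.Combinatorics using (_C_; nCk+nC[k+1]≡[n+1]C[k+1]; k>n⇒nCk≡0; nC1≡n)
open import Data.Nat.Coprimality using (1-coprimeTo) renaming (sym to coprime-sym)
import Data.Integer as ℤ
import Data.Integer.Properties as ℤP
open import Data.Rational using (mkℚ; 0ℚ; 1ℚ)
open import Data.Rational.Properties
import Data.Rational.Unnormalised as ℚᵘ
import Data.Rational.Unnormalised.Properties as ℚᵘP
open import Data.Product using (_,_)
open import Relation.Binary.PropositionalEquality using (refl; sym; trans; cong; cong₂; module ≡-Reasoning)
open import Relation.Nullary.Decidable using (dec⇒maybe)
open import Tactic.RingSolver using (solve-∀)
open import Tactic.RingSolver.Core.AlmostCommutativeRing using (AlmostCommutativeRing; fromCommutativeRing)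
open import Level using (0ℓ)

open ≡-Reasoning

ℚ-ring : AlmostCommutativeRing 0ℓ 0ℓ
ℚ-ring = fromCommutativeRing +-*-commutativeRing (λ q → dec⇒maybe (0ℚ ≟ q))

ℕ→ℚ-mkℚ : ∀ m → ℕ→ℚ m ≡ mkℚ (ℤ.+ m) 0 (coprime-sym (1-coprimeTo m))
ℕ→ℚ-mkℚ m = normalize-coprime (coprime-sym (1-coprimeTo m))

ℕ→ℚ-suc : ∀ m → ℕ→ℚ (suc m) ≡ 1ℚ + ℕ→ℚ m
ℕ→ℚ-suc m rewrite ℕ→ℚ-mkℚ (suc m) | ℕ→ℚ-mkℚ m =
  toℚᵘ-injective (ℚᵘP.≃-trans (ℚᵘ.*≡* cross) (ℚᵘP.≃-sym (toℚᵘ-homo-+ 1ℚ m/1)))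
  where
  m/1 : ℚ
  m/1 = mkℚ (ℤ.+ m) 0 (coprime-sym (1-coprimeTo m))
  -- the cross-multiplied form of  (m+1)/1 = 1/1 + m/1
  cross : ℤ.+ suc m ℤ.* ℤ.+ 1 ≡ (ℤ.+ 1 ℤ.* ℤ.+ 1 ℤ.+ ℤ.+ m ℤ.* ℤ.+ 1) ℤ.* ℤ.+ 1
  cross = trans (ℤP.*-identityʳ _)
    (sym (trans (ℤP.*-identityʳ _) (cong (ℤ._+_ (ℤ.+ 1)) (ℤP.*-identityʳ (ℤ.+ m)))))

ℕ→ℚ-+ : ∀ a b → ℕ→ℚ (a ℕ.+ b) ≡ ℕ→ℚ a + ℕ→ℚ b
ℕ→ℚ-+ zero b = sym (+-identityˡ (ℕ→ℚ b))
ℕ→ℚ-+ (suc a) b = begin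
  ℕ→ℚ (suc (a ℕ.+ b))     ≡⟨ ℕ→ℚ-suc (a ℕ.+ b) ⟩
  1ℚ + ℕ→ℚ (a ℕ.+ b)      ≡⟨ cong (1ℚ +_) (ℕ→ℚ-+ a b) ⟩
  1ℚ + (ℕ→ℚ a + ℕ→ℚ b)    ≡⟨ sym (+-assoc 1ℚ (ℕ→ℚ a) (ℕ→ℚ b)) ⟩
  (1ℚ + ℕ→ℚ a) + ℕ→ℚ b    ≡⟨ cong (_+ ℕ→ℚ b) (sym (ℕ→ℚ-suc a)) ⟩
  ℕ→ℚ (suc a) + ℕ→ℚ b     ∎

ℕ→ℚ-* : ∀ a b → ℕ→ℚ (a ℕ.* b) ≡ ℕ→ℚ a * ℕ→ℚ b
ℕ→ℚ-* zero b = sym (*-zeroˡ (ℕ→ℚ b))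
ℕ→ℚ-* (suc a) b = begin
  ℕ→ℚ (b ℕ.+ a ℕ.* b)       ≡⟨ ℕ→ℚ-+ b (a ℕ.* b) ⟩
  ℕ→ℚ b + ℕ→ℚ (a ℕ.* b)     ≡⟨ cong (ℕ→ℚ b +_) (ℕ→ℚ-* a b) ⟩
  ℕ→ℚ b + ℕ→ℚ a * ℕ→ℚ b     ≡⟨ factor (ℕ→ℚ a) (ℕ→ℚ b) ⟩
  (1ℚ + ℕ→ℚ a) * ℕ→ℚ b      ≡⟨ cong (_* ℕ→ℚ b) (sym (ℕ→ℚ-suc a)) ⟩
  ℕ→ℚ (suc a) * ℕ→ℚ b       ∎
  where
  factor : ∀ p q → q + p * q ≡ (1ℚ + p) * q
  factor = solve-∀ ℚ-ring

inv-suc-inverse : ∀ m → ℕ→ℚ (suc m) * inv-suc m ≡ 1ℚ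
inv-suc-inverse m rewrite ℕ→ℚ-mkℚ (suc m) | normalize-coprime (1-coprimeTo (suc m)) =
  *-inverseʳ (mkℚ (ℤ.+ suc m) 0 (coprime-sym (1-coprimeTo (suc m))))

divide-suc : ∀ n a c → ℕ→ℚ (suc n) * a ≡ c → a ≡ c * inv-suc n
divide-suc n a c eq = begin
  a                              ≡⟨ sym (*-identityʳ a) ⟩
  a * 1ℚ                         ≡⟨ cong (a *_) (sym (inv-suc-inverse n)) ⟩
  a * (ℕ→ℚ (suc n) * inv-suc n)  ≡⟨ regroup a (ℕ→ℚ (suc n)) (inv-suc n) ⟩
  (ℕ→ℚ (suc n) * a) * inv-suc n  ≡⟨ cong (_* inv-suc n) eq ⟩
  c * inv-suc n                  ∎
  where
  regroup : ∀ a N i → a * (N * i) ≡ (N * a) * i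
  regroup = solve-∀ ℚ-ring

binom-pascal : ∀ n k → binom (suc n) (suc k) ≡ binom n k + binom n (suc k)
binom-pascal n k = trans (cong ℕ→ℚ (sym (nCk+nC[k+1]≡[n+1]C[k+1] n k))) (ℕ→ℚ-+ (n C k) (n C suc k))

binom-vanish : ∀ n → binom n (suc n) ≡ 0ℚ
binom-vanish n = cong ℕ→ℚ (k>n⇒nCk≡0 (ℕP.n<1+n n))

absorption : ∀ n k → suc k ℕ.* (suc n C suc k) ≡ suc n ℕ.* (n C k)
absorption zero zero = refl
absorption zero (suc k) = ℕP.*-zeroʳ (suc (suc k))
absorption (suc n) zero = begin
  1 ℕ.* (suc (suc n) C 1)  ≡⟨ ℕP.*-identityˡ _ ⟩
  suc (suc n) C 1          ≡⟨ nC1≡n (suc (suc n)) ⟩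
  suc (suc n)              ≡⟨ sym (ℕP.*-identityʳ (suc (suc n))) ⟩
  suc (suc n) ℕ.* 1        ∎
absorption (suc n) (suc k) = begin
  suc (suc k) ℕ.* (suc (suc n) C suc (suc k))
    ≡⟨ cong (suc (suc k) ℕ.*_) (sym (nCk+nC[k+1]≡[n+1]C[k+1] (suc n) (suc k))) ⟩
  suc (suc k) ℕ.* (A ℕ.+ suc n C suc (suc k))
    ≡⟨ cong (λ a → suc (suc k) ℕ.* (a ℕ.+ suc n C suc (suc k))) (sym (nCk+nC[k+1]≡[n+1]C[k+1] n k)) ⟩
  suc (suc k) ℕ.* ((P ℕ.+ Q) ℕ.+ R)
    ≡⟨ split k P Q R ⟩
  suc k ℕ.* (P ℕ.+ Q) ℕ.+ (P ℕ.+ Q) ℕ.+ suc (suc k) ℕ.* R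
    ≡⟨ cong₂ (λ a b → a ℕ.+ (P ℕ.+ Q) ℕ.+ b)
        (trans (cong (suc k ℕ.*_) (nCk+nC[k+1]≡[n+1]C[k+1] n k)) (absorption n k))
        (absorption n (suc k)) ⟩
  suc n ℕ.* P ℕ.+ (P ℕ.+ Q) ℕ.+ suc n ℕ.* Q
    ≡⟨ merge n P Q ⟩
  suc (suc n) ℕ.* (P ℕ.+ Q)
    ≡⟨ cong (suc (suc n) ℕ.*_) (nCk+nC[k+1]≡[n+1]C[k+1] n k) ⟩
  suc (suc n) ℕ.* A ∎
  where
  A P Q R : ℕ
  A = suc n C suc k
  P = n C k
  Q = n C suc k
  R = suc n C suc (suc k)
  split : ∀ j a b c → suc (suc j) ℕ.* ((a ℕ.+ b) ℕ.+ c) ≡ suc j ℕ.* (a ℕ.+ b) ℕ.+ (a ℕ.+ b) ℕ.+ suc (suc j) ℕ.* c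
  split = ℕSolver.solve-∀
  merge : ∀ m a b → suc m ℕ.* a ℕ.+ (a ℕ.+ b) ℕ.+ suc m ℕ.* b ≡ suc (suc m) ℕ.* (a ℕ.+ b)
  merge = ℕSolver.solve-∀

binom-absorption : ∀ n k → ℕ→ℚ (suc n) * binom n k ≡ ℕ→ℚ (suc k) * binom (suc n) (suc k)
binom-absorption n k = begin
  ℕ→ℚ (suc n) * binom n k                  ≡⟨ sym (ℕ→ℚ-* (suc n) (n C k)) ⟩
  ℕ→ℚ (suc n ℕ.* (n C k))                  ≡⟨ cong ℕ→ℚ (sym (absorption n k)) ⟩
  ℕ→ℚ (suc k ℕ.* (suc n C suc k))          ≡⟨ ℕ→ℚ-* (suc k) (suc n C suc k) ⟩
  ℕ→ℚ (suc k) * binom (suc n) (suc k)      ∎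

sumTo-cong : ∀ {f g : ℕ → ℚ} → (∀ k → f k ≡ g k) → ∀ n → sumTo f n ≡ sumTo g n
sumTo-cong f≡g zero = f≡g zero
sumTo-cong f≡g (suc n) = cong₂ _+_ (sumTo-cong f≡g n) (f≡g (suc n))

sum1To-cong : ∀ {f g : ℕ → ℚ} → (∀ k → f k ≡ g k) → ∀ n → sum1To f n ≡ sum1To g n
sum1To-cong f≡g zero = refl
sum1To-cong f≡g (suc n) = cong₂ _+_ (sum1To-cong f≡g n) (f≡g (suc n))

sumTo-+ : ∀ (f g : ℕ → ℚ) n → sumTo (λ k → f k + g k) n ≡ sumTo f n + sumTo g n
sumTo-+ f g zero = refl
sumTo-+ f g (suc n) = trans (cong (_+ (f (suc n) + g (suc n))) (sumTo-+ f g n))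
                            (interchange (sumTo f n) (sumTo g n) (f (suc n)) (g (suc n)))
  where
  interchange : ∀ a b c d → (a + b) + (c + d) ≡ (a + c) + (b + d)
  interchange = solve-∀ ℚ-ring

sumTo-- : ∀ (f g : ℕ → ℚ) n → sumTo (λ k → f k - g k) n ≡ sumTo f n - sumTo g n
sumTo-- f g zero = refl
sumTo-- f g (suc n) = trans (cong (_+ (f (suc n) - g (suc n))) (sumTo-- f g n))
                            (interchange (sumTo f n) (sumTo g n) (f (suc n)) (g (suc n)))
  where
  interchange : ∀ a b c d → (a - b) + (c - d) ≡ (a + c) - (b + d)
  interchange = solve-∀ ℚ-ring

sumTo-* : ∀ (c : ℚ) (f : ℕ → ℚ) n → sumTo (λ k → c * f k) n ≡ c * sumTo f n
sumTo-* c f zero = refl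
sumTo-* c f (suc n) = trans (cong (_+ (c * f (suc n))) (sumTo-* c f n))
                            (sym (*-distribˡ-+ c (sumTo f n) (f (suc n))))

sum1To-* : ∀ (c : ℚ) (f : ℕ → ℚ) n → sum1To (λ k → c * f k) n ≡ c * sum1To f n
sum1To-* c f zero = sym (*-zeroʳ c)
sum1To-* c f (suc n) = trans (cong (_+ (c * f (suc n))) (sum1To-* c f n))
                             (sym (*-distribˡ-+ c (sum1To f n) (f (suc n))))

sumTo-shift : ∀ (f : ℕ → ℚ) n → sumTo f (suc n) ≡ f 0 + sumTo (λ k → f (suc k)) n
sumTo-shift f zero = refl
sumTo-shift f (suc n) = trans (cong (_+ f (suc (suc n))) (sumTo-shift f n))
                              (+-assoc (f 0) (sumTo (λ k → f (suc k)) n) (f (suc (suc n))))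

sum1To-shift : ∀ (f : ℕ → ℚ) n → sum1To f (suc n) ≡ f 1 + sum1To (λ k → f (suc k)) n
sum1To-shift f zero = trans (+-identityˡ (f 1)) (sym (+-identityʳ (f 1)))
sum1To-shift f (suc n) = trans (cong (_+ f (suc (suc n))) (sum1To-shift f n))
                               (+-assoc (f 1) (sum1To (λ k → f (suc k)) n) (f (suc (suc n))))

binomSum : ℕ → (ℕ → ℚ) → ℚ
binomSum n g = sumTo (λ k → binom n k * g k) n

binomSum-cong : ∀ n {f g : ℕ → ℚ} → (∀ k → f k ≡ g k) → binomSum n f ≡ binomSum n g
binomSum-cong n f≡g = sumTo-cong (λ k → cong (binom n k *_) (f≡g k)) n

binomSum-+ : ∀ n f g → binomSum n (λ k → f k + g k) ≡ binomSum n f + binomSum n g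
binomSum-+ n f g = trans (sumTo-cong (λ k → *-distribˡ-+ (binom n k) (f k) (g k)) n) (sumTo-+ _ _ n)

binomSum-- : ∀ n f g → binomSum n (λ k → f k - g k) ≡ binomSum n f - binomSum n g
binomSum-- n f g = trans (sumTo-cong (λ k → distrib (binom n k) (f k) (g k)) n) (sumTo-- _ _ n)
  where
  distrib : ∀ b p q → b * (p - q) ≡ b * p - b * q
  distrib = solve-∀ ℚ-ring

binomSum-* : ∀ n c g → binomSum n (λ k → c * g k) ≡ c * binomSum n g
binomSum-* n c g = trans (sumTo-cong (λ k → swap (binom n k) c (g k)) n) (sumTo-* c _ n)
  where
  swap : ∀ b c p → b * (c * p) ≡ c * (b * p)
  swap = solve-∀ ℚ-ring

binomSum-extend : ∀ n g → sumTo (λ k → binom n k * g k) (suc n) ≡ binomSum n g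
binomSum-extend n g = begin
  binomSum n g + binom n (suc n) * g (suc n)  ≡⟨ cong (λ b → binomSum n g + b * g (suc n)) (binom-vanish n) ⟩
  binomSum n g + 0ℚ * g (suc n)               ≡⟨ cong (binomSum n g +_) (*-zeroˡ (g (suc n))) ⟩
  binomSum n g + 0ℚ                           ≡⟨ +-identityʳ (binomSum n g) ⟩
  binomSum n g                                ∎

binomSum-pascal : ∀ n g → binomSum (suc n) g ≡ binomSum n g + binomSum n (λ k → g (suc k))
binomSum-pascal n g = begin
  binomSum (suc n) g
    ≡⟨ sumTo-shift _ n ⟩
  g₀ + sumTo (λ k → binom (suc n) (suc k) * g (suc k)) n
    ≡⟨ cong (g₀ +_) (sumTo-cong (λ k → trans (cong (_* g (suc k)) (binom-pascal n k))
                                             (*-distribʳ-+ (g (suc k)) (binom n k) _)) n) ⟩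
  g₀ + sumTo (λ k → binom n k * g (suc k) + binom n (suc k) * g (suc k)) n
    ≡⟨ cong (g₀ +_) (sumTo-+ _ _ n) ⟩
  g₀ + (binomSum n (λ k → g (suc k)) + tail)
    ≡⟨ rotate g₀ (binomSum n (λ k → g (suc k))) tail ⟩
  (g₀ + tail) + binomSum n (λ k → g (suc k))
    ≡⟨ cong (_+ binomSum n (λ k → g (suc k))) (sym (sumTo-shift (λ k → binom n k * g k) n)) ⟩
  sumTo (λ k → binom n k * g k) (suc n) + binomSum n (λ k → g (suc k))
    ≡⟨ cong (_+ binomSum n (λ k → g (suc k))) (binomSum-extend n g) ⟩
  binomSum n g + binomSum n (λ k → g (suc k)) ∎
  where
  g₀ tail : ℚ
  g₀ = binom n 0 * g 0
  tail = sumTo (λ k → binom n (suc k) * g (suc k)) n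
  rotate : ∀ a b c → a + (b + c) ≡ (a + c) + b
  rotate = solve-∀ ℚ-ring

binomSum-absorption : ∀ n g →
  ℕ→ℚ (suc n) * binomSum n (λ k → inv-suc k * g (suc k)) ≡ binomSum (suc n) g - g 0
binomSum-absorption n g = begin
  ℕ→ℚ (suc n) * binomSum n (λ k → inv-suc k * g (suc k))
    ≡⟨ sym (sumTo-* (ℕ→ℚ (suc n)) _ n) ⟩
  sumTo (λ k → ℕ→ℚ (suc n) * (binom n k * (inv-suc k * g (suc k)))) n
    ≡⟨ sumTo-cong absorb-term n ⟩
  tail
    ≡⟨ peel (binomSum (suc n) g) (g 0) tail (sumTo-shift _ n) ⟩
  binomSum (suc n) g - g 0 ∎
  where
  tail : ℚ
  tail = sumTo (λ k → binom (suc n) (suc k) * g (suc k)) n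
  absorb-term : ∀ k → ℕ→ℚ (suc n) * (binom n k * (inv-suc k * g (suc k))) ≡ binom (suc n) (suc k) * g (suc k)
  absorb-term k = begin
    ℕ→ℚ (suc n) * (binom n k * (inv-suc k * g (suc k)))
      ≡⟨ regroup (ℕ→ℚ (suc n)) (binom n k) (inv-suc k) (g (suc k)) ⟩
    (ℕ→ℚ (suc n) * binom n k) * (inv-suc k * g (suc k))
      ≡⟨ cong (_* (inv-suc k * g (suc k))) (binom-absorption n k) ⟩
    (ℕ→ℚ (suc k) * binom (suc n) (suc k)) * (inv-suc k * g (suc k))
      ≡⟨ regroup′ (ℕ→ℚ (suc k)) (binom (suc n) (suc k)) (inv-suc k) (g (suc k)) ⟩
    (ℕ→ℚ (suc k) * inv-suc k) * (binom (suc n) (suc k) * g (suc k))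
      ≡⟨ cong (_* (binom (suc n) (suc k) * g (suc k))) (inv-suc-inverse k) ⟩
    1ℚ * (binom (suc n) (suc k) * g (suc k))
      ≡⟨ *-identityˡ _ ⟩
    binom (suc n) (suc k) * g (suc k) ∎
    where
    regroup : ∀ N b i p → N * (b * (i * p)) ≡ (N * b) * (i * p)
    regroup = solve-∀ ℚ-ring
    regroup′ : ∀ K b i p → (K * b) * (i * p) ≡ (K * i) * (b * p)
    regroup′ = solve-∀ ℚ-ring
  peel : ∀ s a t → s ≡ 1ℚ * a + t → t ≡ s - a
  peel s a t s≡ = trans (cancel a t) (cong (_- a) (sym s≡))
    where
    cancel : ∀ a t → t ≡ 1ℚ * a + t - a
    cancel = solve-∀ ℚ-ring

module ClosedForms (x : ℚ) where

  y : ℚ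
  y = 1ℚ + x

  V : ℕ → ℚ
  V m = sum1To (λ k → inv k * y ^ k) m

  -- W z m = Σ_{i=1}^{m} zⁱ/i, used with z = 1/y
  W : ℚ → ℕ → ℚ
  W z m = sum1To (λ k → z ^ k * inv k) m

  V-suc : ∀ n → V (suc n) ≡ y * (1ℚ + sum1To (λ k → inv-suc k * y ^ k) n)
  V-suc n = begin
    V (suc n)
      ≡⟨ sum1To-shift _ n ⟩
    inv 1 * (y * 1ℚ) + sum1To (λ k → inv-suc k * (y * y ^ k)) n
      ≡⟨ cong (inv 1 * (y * 1ℚ) +_) (sum1To-cong (λ k → swap (inv-suc k) y (y ^ k)) n) ⟩
    inv 1 * (y * 1ℚ) + sum1To (λ k → y * (inv-suc k * y ^ k)) n
      ≡⟨ cong (inv 1 * (y * 1ℚ) +_) (sum1To-* y _ n) ⟩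
    1ℚ * (y * 1ℚ) + y * sum1To (λ k → inv-suc k * y ^ k) n
      ≡⟨ factor y (sum1To (λ k → inv-suc k * y ^ k) n) ⟩
    y * (1ℚ + sum1To (λ k → inv-suc k * y ^ k) n) ∎
    where
    swap : ∀ i y p → i * (y * p) ≡ y * (i * p)
    swap = solve-∀ ℚ-ring
    factor : ∀ y s → 1ℚ * (y * 1ℚ) + y * s ≡ y * (1ℚ + s)
    factor = solve-∀ ℚ-ring

  binomial-theorem : ∀ n → binomSum n (x ^_) ≡ y ^ n
  binomial-theorem zero = refl
  binomial-theorem (suc n) = begin
    binomSum (suc n) (x ^_)              ≡⟨ binomSum-pascal n (x ^_) ⟩
    binomSum n (x ^_) + binomSum n (λ k → x * x ^ k)
                                         ≡⟨ cong (binomSum n (x ^_) +_) (binomSum-* n x (x ^_)) ⟩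
    binomSum n (x ^_) + x * binomSum n (x ^_)
                                         ≡⟨ cong (λ s → s + x * s) (binomial-theorem n) ⟩
    y ^ n + x * y ^ n                    ≡⟨ factor (y ^ n) x ⟩
    (1ℚ + x) * y ^ n                     ∎
    where
    factor : ∀ a x → a + x * a ≡ (1ℚ + x) * a
    factor = solve-∀ ℚ-ring

  integrated-binomial : ∀ n → binomSum n (λ k → inv-suc k * x ^ suc k) ≡ (y ^ suc n - 1ℚ) * inv-suc n
  integrated-binomial n = divide-suc n _ _ (begin
    ℕ→ℚ (suc n) * binomSum n (λ k → inv-suc k * x ^ suc k) ≡⟨ binomSum-absorption n (x ^_) ⟩
    binomSum (suc n) (x ^_) - 1ℚ                           ≡⟨ cong (_- 1ℚ) (binomial-theorem (suc n)) ⟩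
    y ^ suc n - 1ℚ                                         ∎)

  -- Σ C(m,k) xᵏ/k = 1 + V m - H m, where the k = 0 term is read as 1.
  reciprocal-binomSum : ∀ m → binomSum m (λ k → inv k * x ^ k) ≡ 1ℚ + V m - H m
  reciprocal-binomSum zero = refl
  reciprocal-binomSum (suc m) = begin
    binomSum (suc m) (λ k → inv k * x ^ k)
      ≡⟨ binomSum-pascal m _ ⟩
    binomSum m (λ k → inv k * x ^ k) + binomSum m (λ k → inv-suc k * x ^ suc k)
      ≡⟨ cong₂ _+_ (reciprocal-binomSum m) (integrated-binomial m) ⟩
    (1ℚ + V m - H m) + (y ^ suc m - 1ℚ) * inv-suc m
      ≡⟨ rearrange (V m) (H m) (y ^ suc m) (inv-suc m) ⟩
    1ℚ + (V m + inv-suc m * y ^ suc m) - (H m + inv-suc m) ∎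
    where
    rearrange : ∀ v h Y i → (1ℚ + v - h) + (Y - 1ℚ) * i ≡ 1ℚ + (v + i * Y) - (h + i)
    rearrange = solve-∀ ℚ-ring

  absorb-ratio : ∀ n f g → (∀ k → inv-suc k * g (suc k) ≡ x * f k) →
    ℕ→ℚ (suc n) * (x * binomSum n f) ≡ binomSum (suc n) g - g 0
  absorb-ratio n f g g≡xf = begin
    ℕ→ℚ (suc n) * (x * binomSum n f)                          ≡⟨ cong (ℕ→ℚ (suc n) *_) (sym (binomSum-* n x f)) ⟩
    ℕ→ℚ (suc n) * binomSum n (λ k → x * f k)                  ≡⟨ cong (ℕ→ℚ (suc n) *_) (binomSum-cong n (λ k → sym (g≡xf k))) ⟩
    ℕ→ℚ (suc n) * binomSum n (λ k → inv-suc k * g (suc k))    ≡⟨ binomSum-absorption n g ⟩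
    binomSum (suc n) g - g 0                                  ∎

  reciprocal-square-absorbed : ∀ n →
    ℕ→ℚ (suc n) * (x * binomSum n (λ k → inv-suc k * inv-suc k * x ^ k)) ≡ V (suc n) - H (suc n)
  reciprocal-square-absorbed n = begin
    ℕ→ℚ (suc n) * (x * binomSum n (λ k → inv-suc k * inv-suc k * x ^ k))
      ≡⟨ absorb-ratio n _ (λ k → inv k * x ^ k) (λ k → shape (inv-suc k) x (x ^ k)) ⟩
    binomSum (suc n) (λ k → inv k * x ^ k) - 1ℚ
      ≡⟨ cong (_- 1ℚ) (reciprocal-binomSum (suc n)) ⟩
    1ℚ + V (suc n) - H (suc n) - 1ℚ
      ≡⟨ cancel (V (suc n)) (H (suc n)) ⟩
    V (suc n) - H (suc n) ∎
    where
    shape : ∀ i x p → i * (i * (x * p)) ≡ x * (i * i * p)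
    shape = solve-∀ ℚ-ring
    cancel : ∀ v h → 1ℚ + v - h - 1ℚ ≡ v - h
    cancel = solve-∀ ℚ-ring

  module _ (z : ℚ) (yz≡1 : y * z ≡ 1ℚ) where

    powers-inverse : ∀ k → y ^ k * z ^ k ≡ 1ℚ
    powers-inverse zero = refl
    powers-inverse (suc k) = begin
      (y * y ^ k) * (z * z ^ k)    ≡⟨ interchange y (y ^ k) z (z ^ k) ⟩
      (y * z) * (y ^ k * z ^ k)    ≡⟨ cong₂ _*_ yz≡1 (powers-inverse k) ⟩
      1ℚ * 1ℚ                      ≡⟨⟩
      1ℚ                           ∎
      where
      interchange : ∀ a b c d → (a * b) * (c * d) ≡ (a * c) * (b * d)
      interchange = solve-∀ ℚ-ring

    harmonic-binomSum : ∀ m → binomSum m (λ k → H k * x ^ k) ≡ y ^ m * (H m - W z m)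
    harmonic-binomSum zero = refl
    harmonic-binomSum (suc m) = begin
      binomSum (suc m) (λ k → H k * x ^ k)
        ≡⟨ binomSum-pascal m _ ⟩
      E + binomSum m (λ k → (H k + inv-suc k) * (x * x ^ k))
        ≡⟨ cong (E +_) (binomSum-cong m (λ k → distrib (H k) (inv-suc k) x (x ^ k))) ⟩
      E + binomSum m (λ k → x * (H k * x ^ k) + inv-suc k * x ^ suc k)
        ≡⟨ cong (E +_) (binomSum-+ m _ _) ⟩
      E + (binomSum m (λ k → x * (H k * x ^ k)) + binomSum m (λ k → inv-suc k * x ^ suc k))
        ≡⟨ cong (E +_) (cong₂ _+_ (binomSum-* m x _) (integrated-binomial m)) ⟩
      E + (x * E + (y ^ suc m - 1ℚ) * inv-suc m)
        ≡⟨ cong (λ e → e + (x * e + (y ^ suc m - 1ℚ) * inv-suc m)) (harmonic-binomSum m) ⟩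
      u * (H m - W z m) + (x * (u * (H m - W z m)) + ((1ℚ + x) * u - 1ℚ) * inv-suc m)
        ≡⟨ collect x u (H m) (W z m) (inv-suc m) (z ^ suc m) (powers-inverse (suc m)) ⟩
      (1ℚ + x) * u * (H m + inv-suc m - (W z m + z ^ suc m * inv-suc m)) ∎
      where
      E u : ℚ
      E = binomSum m (λ k → H k * x ^ k)
      u = y ^ m
      distrib : ∀ h i x p → (h + i) * (x * p) ≡ x * (h * p) + i * (x * p)
      distrib = solve-∀ ℚ-ring
      collect : ∀ x u h w i Z → (1ℚ + x) * u * Z ≡ 1ℚ →
        u * (h - w) + (x * (u * (h - w)) + ((1ℚ + x) * u - 1ℚ) * i)
          ≡ (1ℚ + x) * u * (h + i - (w + Z * i))
      collect x u h w i Z yuZ≡1 = begin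
        u * (h - w) + (x * (u * (h - w)) + ((1ℚ + x) * u - 1ℚ) * i)
          ≡⟨ expand x u h w i ⟩
        (1ℚ + x) * u * (h - w) + (1ℚ + x) * u * i - 1ℚ * i
          ≡⟨ cong (λ c → (1ℚ + x) * u * (h - w) + (1ℚ + x) * u * i - c * i) (sym yuZ≡1) ⟩
        (1ℚ + x) * u * (h - w) + (1ℚ + x) * u * i - ((1ℚ + x) * u * Z) * i
          ≡⟨ factor x u h w i Z ⟩
        (1ℚ + x) * u * (h + i - (w + Z * i)) ∎
        where
        expand : ∀ x u h w i → u * (h - w) + (x * (u * (h - w)) + ((1ℚ + x) * u - 1ℚ) * i)
                             ≡ (1ℚ + x) * u * (h - w) + (1ℚ + x) * u * i - 1ℚ * i
        expand = solve-∀ ℚ-ring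
        factor : ∀ x u h w i Z → (1ℚ + x) * u * (h - w) + (1ℚ + x) * u * i - ((1ℚ + x) * u * Z) * i
                               ≡ (1ℚ + x) * u * (h + i - (w + Z * i))
        factor = solve-∀ ℚ-ring

    harmonic-absorbed : ∀ n →
      ℕ→ℚ (suc n) * (x * binomSum n (λ k → H k * inv-suc k * x ^ k)) ≡ y ^ suc n * (H n - W z n) + H n - V n
    harmonic-absorbed n = begin
      ℕ→ℚ (suc n) * (x * binomSum n (λ k → H k * inv-suc k * x ^ k))
        ≡⟨ absorb-ratio n _ g (λ k → shape (H k) (inv-suc k) x (x ^ k)) ⟩
      binomSum (suc n) g - g 0
        ≡⟨ cong (_- g 0) (binomSum-- (suc n) _ _) ⟩
      binomSum (suc n) (λ k → H k * x ^ k) - binomSum (suc n) (λ k → inv k * x ^ k) - g 0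
        ≡⟨ cong₂ (λ a b → a - b - g 0) (harmonic-binomSum (suc n)) (reciprocal-binomSum (suc n)) ⟩
      y ^ suc n * (H n + inv-suc n - (W z n + z ^ suc n * inv-suc n))
        - (1ℚ + (V n + inv-suc n * y ^ suc n) - (H n + inv-suc n)) - - 1ℚ
        ≡⟨ collapse (y ^ suc n) (z ^ suc n) (H n) (W z n) (V n) (inv-suc n) (powers-inverse (suc n)) ⟩
      y ^ suc n * (H n - W z n) + H n - V n ∎
      where
      g : ℕ → ℚ
      g k = H k * x ^ k - inv k * x ^ k
      shape : ∀ h i x p → i * ((h + i) * (x * p) - i * (x * p)) ≡ x * (h * i * p)
      shape = solve-∀ ℚ-ring
      collapse : ∀ Y Z h w v i → Y * Z ≡ 1ℚ →
        Y * (h + i - (w + Z * i)) - (1ℚ + (v + i * Y) - (h + i)) - - 1ℚ ≡ Y * (h - w) + h - v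
      collapse Y Z h w v i YZ≡1 = begin
        Y * (h + i - (w + Z * i)) - (1ℚ + (v + i * Y) - (h + i)) - - 1ℚ
          ≡⟨ expand Y Z h w v i ⟩
        Y * (h - w) + h - v + (1ℚ - Y * Z) * i
          ≡⟨ cong (λ c → Y * (h - w) + h - v + (1ℚ - c) * i) YZ≡1 ⟩
        Y * (h - w) + h - v + (1ℚ - 1ℚ) * i
          ≡⟨ drop (Y * (h - w) + h - v) i ⟩
        Y * (h - w) + h - v ∎
        where
        expand : ∀ Y Z h w v i → Y * (h + i - (w + Z * i)) - (1ℚ + (v + i * Y) - (h + i)) - - 1ℚ
                               ≡ Y * (h - w) + h - v + (1ℚ - Y * Z) * i
        expand = solve-∀ ℚ-ring
        drop : ∀ a i → a + (1ℚ - 1ℚ) * i ≡ a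
        drop = solve-∀ ℚ-ring

-- Solving for the sums: the constants enter only through  t q x = 1  and
-- t q y = q  (with t = -3, q = 1/4, x = -4/3, y = -1/3), and  q - t q = 1.

solve-for : ∀ a b c d → a * b ≡ 1ℚ → b * c ≡ d → c ≡ a * d
solve-for a b c d ab≡1 bc≡d = begin
  c              ≡⟨ sym (*-identityˡ c) ⟩
  1ℚ * c         ≡⟨ cong (_* c) (sym ab≡1) ⟩
  (a * b) * c    ≡⟨ *-assoc a b c ⟩
  a * (b * c)    ≡⟨ cong (a *_) bc≡d ⟩
  a * d          ∎

solve-harmonic : ∀ t q x y u h w v i R → t * q * x ≡ 1ℚ → t * q * y ≡ q →
  x * R ≡ (y * u * (h - w) + h - v) * i →
  R ≡ (t + u) * h * (q * i) - w * u * (q * i) + (- t) * v * (q * i)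
solve-harmonic t q x y u h w v i R tqx≡1 tqy≡q xR≡ = begin
  R                                                       ≡⟨ solve-for (t * q) x R _ tqx≡1 xR≡ ⟩
  t * q * ((y * u * (h - w) + h - v) * i)                 ≡⟨ expand t q y u h w v i ⟩
  (t * q * y) * u * (h - w) * i + t * q * (h - v) * i     ≡⟨ cong (λ c → c * u * (h - w) * i + t * q * (h - v) * i) tqy≡q ⟩
  q * u * (h - w) * i + t * q * (h - v) * i               ≡⟨ collect t q u h w v i ⟩
  (t + u) * h * (q * i) - w * u * (q * i) + (- t) * v * (q * i) ∎
  where
  expand : ∀ t q y u h w v i → t * q * ((y * u * (h - w) + h - v) * i)
                             ≡ (t * q * y) * u * (h - w) * i + t * q * (h - v) * i
  expand = solve-∀ ℚ-ring
  collect : ∀ t q u h w v i → q * u * (h - w) * i + t * q * (h - v) * i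
                            ≡ (t + u) * h * (q * i) - w * u * (q * i) + (- t) * v * (q * i)
  collect = solve-∀ ℚ-ring

solve-square : ∀ t q x y s₁ s₂ i Q → t * q * x ≡ 1ℚ → t * q * y ≡ q → q - t * q ≡ 1ℚ →
  x * Q ≡ (y * (1ℚ + s₂) - (1ℚ + s₁)) * i →
  Q ≡ i + (- t) * s₁ * (q * i) + s₂ * (q * i)
solve-square t q x y s₁ s₂ i Q tqx≡1 tqy≡q q-tq≡1 xQ≡ = begin
  Q                                                          ≡⟨ solve-for (t * q) x Q _ tqx≡1 xQ≡ ⟩
  t * q * ((y * (1ℚ + s₂) - (1ℚ + s₁)) * i)                  ≡⟨ expand t q y s₁ s₂ i ⟩
  (t * q * y) * (1ℚ + s₂) * i - t * q * (1ℚ + s₁) * i        ≡⟨ cong (λ c → c * (1ℚ + s₂) * i - t * q * (1ℚ + s₁) * i) tqy≡q ⟩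
  q * (1ℚ + s₂) * i - t * q * (1ℚ + s₁) * i                  ≡⟨ regroup t q s₁ s₂ i ⟩
  (q - t * q) * i + (- t) * s₁ * (q * i) + s₂ * (q * i)      ≡⟨ cong (λ c → c * i + (- t) * s₁ * (q * i) + s₂ * (q * i)) q-tq≡1 ⟩
  1ℚ * i + (- t) * s₁ * (q * i) + s₂ * (q * i)               ≡⟨ cong (λ c → c + (- t) * s₁ * (q * i) + s₂ * (q * i)) (*-identityˡ i) ⟩
  i + (- t) * s₁ * (q * i) + s₂ * (q * i)                    ∎
  where
  expand : ∀ t q y s₁ s₂ i → t * q * ((y * (1ℚ + s₂) - (1ℚ + s₁)) * i)
                           ≡ (t * q * y) * (1ℚ + s₂) * i - t * q * (1ℚ + s₁) * i
  expand = solve-∀ ℚ-ring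
  regroup : ∀ t q s₁ s₂ i → q * (1ℚ + s₂) * i - t * q * (1ℚ + s₁) * i
                          ≡ (q - t * q) * i + (- t) * s₁ * (q * i) + s₂ * (q * i)
  regroup = solve-∀ ℚ-ring

open ClosedForms q-4/3

quarter : ∀ n → inv-suc (4 ℕ.* n ℕ.+ 3) ≡ inv-suc 3 * inv-suc n
quarter n = sym (trans (divide-suc (4 ℕ.* n ℕ.+ 3) _ 1ℚ four-inverse) (*-identityˡ _))
  where
  four-inverse : ℕ→ℚ (suc (4 ℕ.* n ℕ.+ 3)) * (inv-suc 3 * inv-suc n) ≡ 1ℚ
  four-inverse = begin
    ℕ→ℚ (suc (4 ℕ.* n ℕ.+ 3)) * (inv-suc 3 * inv-suc n)  ≡⟨ cong (λ m → ℕ→ℚ m * (inv-suc 3 * inv-suc n)) (times-four n) ⟩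
    ℕ→ℚ (4 ℕ.* suc n) * (inv-suc 3 * inv-suc n)          ≡⟨ cong (_* (inv-suc 3 * inv-suc n)) (ℕ→ℚ-* 4 (suc n)) ⟩
    (ℕ→ℚ 4 * ℕ→ℚ (suc n)) * (inv-suc 3 * inv-suc n)      ≡⟨ interchange (ℕ→ℚ 4) (ℕ→ℚ (suc n)) (inv-suc 3) (inv-suc n) ⟩
    (ℕ→ℚ 4 * inv-suc 3) * (ℕ→ℚ (suc n) * inv-suc n)      ≡⟨ cong₂ _*_ (inv-suc-inverse 3) (inv-suc-inverse n) ⟩
    1ℚ * 1ℚ                                              ≡⟨⟩
    1ℚ                                                   ∎
    where
    times-four : ∀ n → suc (4 ℕ.* n ℕ.+ 3) ≡ 4 ℕ.* suc n
    times-four = ℕSolver.solve-∀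
    interchange : ∀ a b c d → (a * b) * (c * d) ≡ (a * c) * (b * d)
    interchange = solve-∀ ℚ-ring

reassoc : ∀ b p q r → b * p * q * r ≡ b * (p * q * r)
reassoc = solve-∀ ℚ-ring

harmonic-identity : ∀ n →
  sumTo (λ k → binom n k * H k * inv-suc k * (q-4/3 ^ k)) n
    ≡ (q-3 + q-1/3 ^ n) * H n * inv-suc (4 ℕ.* n ℕ.+ 3)
      - sum1To (λ k → (q-3 ^ k) * inv k) n * (q-1/3 ^ n) * inv-suc (4 ℕ.* n ℕ.+ 3)
      + q3 * sum1To (λ k → inv k * (q-1/3 ^ k)) n * inv-suc (4 ℕ.* n ℕ.+ 3)
harmonic-identity n = begin
  sumTo (λ k → binom n k * H k * inv-suc k * (q-4/3 ^ k)) n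
    ≡⟨ sumTo-cong (λ k → reassoc (binom n k) (H k) (inv-suc k) (q-4/3 ^ k)) n ⟩
  binomSum n (λ k → H k * inv-suc k * q-4/3 ^ k)
    ≡⟨ solve-harmonic q-3 (inv-suc 3) q-4/3 y (y ^ n) (H n) (W q-3 n) (V n) (inv-suc n) _ refl refl
         (divide-suc n _ _ (harmonic-absorbed q-3 refl n)) ⟩
  (q-3 + y ^ n) * H n * c′ - W q-3 n * y ^ n * c′ + q3 * V n * c′
    ≡⟨ cong (λ c → (q-3 + y ^ n) * H n * c - W q-3 n * y ^ n * c + q3 * V n * c) (sym (quarter n)) ⟩
  (q-3 + y ^ n) * H n * c - W q-3 n * y ^ n * c + q3 * V n * c ∎
  where
  c c′ : ℚ
  c = inv-suc (4 ℕ.* n ℕ.+ 3)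
  c′ = inv-suc 3 * inv-suc n

reciprocal-square-identity : ∀ n →
  sumTo (λ k → binom n k * inv-suc k * inv-suc k * (q-4/3 ^ k)) n
    ≡ inv-suc n
      + q3 * sum1To (λ k → inv-suc k) n * inv-suc (4 ℕ.* n ℕ.+ 3)
      + sum1To (λ k → inv-suc k * (q-1/3 ^ k)) n * inv-suc (4 ℕ.* n ℕ.+ 3)
reciprocal-square-identity n = begin
  sumTo (λ k → binom n k * inv-suc k * inv-suc k * (q-4/3 ^ k)) n
    ≡⟨ sumTo-cong (λ k → reassoc (binom n k) (inv-suc k) (inv-suc k) (q-4/3 ^ k)) n ⟩
  binomSum n (λ k → inv-suc k * inv-suc k * q-4/3 ^ k)
    ≡⟨ solve-square q-3 (inv-suc 3) q-4/3 y S₁ S₂ (inv-suc n) _ refl refl refl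
         (divide-suc n _ _ absorbed) ⟩
  inv-suc n + q3 * S₁ * c′ + S₂ * c′
    ≡⟨ cong (λ c → inv-suc n + q3 * S₁ * c + S₂ * c) (sym (quarter n)) ⟩
  inv-suc n + q3 * S₁ * c + S₂ * c ∎
  where
  c c′ S₁ S₂ : ℚ
  c = inv-suc (4 ℕ.* n ℕ.+ 3)
  c′ = inv-suc 3 * inv-suc n
  S₁ = sum1To (λ k → inv-suc k) n
  S₂ = sum1To (λ k → inv-suc k * y ^ k) n
  absorbed : ℕ→ℚ (suc n) * (q-4/3 * binomSum n (λ k → inv-suc k * inv-suc k * q-4/3 ^ k))
           ≡ y * (1ℚ + S₂) - (1ℚ + S₁)
  absorbed = trans (reciprocal-square-absorbed n) (cong₂ _-_ (V-suc n) (sum1To-shift inv n))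

lemma3p3 : (n : ℕ) →
    (sumTo (λ k → binom n k * H k * inv-suc k * (q-4/3 ^ k)) n
      ≡ (q-3 + q-1/3 ^ n) * H n * inv-suc (4 ℕ.* n ℕ.+ 3)
        - sum1To (λ k → (q-3 ^ k) * inv k) n * (q-1/3 ^ n) * inv-suc (4 ℕ.* n ℕ.+ 3)
        + q3 * sum1To (λ k → inv k * (q-1/3 ^ k)) n * inv-suc (4 ℕ.* n ℕ.+ 3))
    ×
    (sumTo (λ k → binom n k * inv-suc k * inv-suc k * (q-4/3 ^ k)) n
      ≡ inv-suc n
        + q3 * sum1To (λ k → inv-suc k) n * inv-suc (4 ℕ.* n ℕ.+ 3)
        + sum1To (λ k → inv-suc k * (q-1/3 ^ k)) n * inv-suc (4 ℕ.* n ℕ.+ 3))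
lemma3p3 n = harmonic-identity n , reciprocal-square-identity n
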